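{- Let $k \in \mathbb Z_+$ and $p, p_1, p_2 \in [0, 1]$ be such that $p k$, $p_1 k$, and $p_2 k$ are integers and $p \ge p_1 p_2$. Let $X^{(i)} \in \{0, 1\}^2$, $i\in[k]$, be independent identically distributed variables. Then \[ \Pr\left[\forall l \le k : \sum_{i \in [l]} X^{(i)} \ge \begin{pmatrix}p_1 \\ p_2 \end{pmatrix} l \;\middle|\; \sum_{i \in [k]} X^{(i)} = \begin{pmatrix}p_1 \\ p_2 \end{pmatrix} k \wedge \sum_{i \in [k]} X^{(i)}_1 X^{(i)}_2 = p k\right] \ge k^{ -3} . \]
   Context: Vector inequalities are coordinatewise. The proof uses the folklore cyclic-rotation ("truck driver's") lemma: if $\sum_{i\in[k]}a_i\ge 0$ then some cyclic rotation has all prefix sums nonnegative.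
   Formalization: The common distribution of the variables $X^{(i)}$ assigns rational probabilities to the four values in {0,1}². -}

module Defs where

open import Data.Bool using (Bool; true; false)
open import Data.Nat as ℕ using (ℕ; zero; suc)
open import Data.Integer using (+_)
open import Data.Rational using (ℚ; 0ℚ; _+_; _*_; _≤_; _/_)
open import Data.Rational.Properties using (_≟_; _≤?_)
open import Data.Product using (_×_; _,_; proj₁; proj₂)
open import Data.List using (List; []; _∷_; map; concatMap; take; filter; upTo; foldr)
open import Data.List.Relation.Unary.All using (All; all?)
open import Relation.Binary.PropositionalEquality using (_≡_)
open import Relation.Nullary using (Dec; _×-dec_)
open import Relation.Unary using (Decidable)

⟦_⟧ : ℕ → ℚ
⟦ n ⟧ = + n / 1

-- a value of X ∈ {0,1}², encoded as a pair of bits (true = 1)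
Outcome : Set
Outcome = Bool × Bool

outcomes : List Outcome
outcomes = (false , false) ∷ (false , true) ∷ (true , false) ∷ (true , true) ∷ []

bit : Bool → ℕ
bit false = 0
bit true  = 1

-- a realisation (X⁽¹⁾, …, X⁽ᵏ⁾) is a list of outcomes of length k;
-- the sample space {0,1}²ᵏ enumerated:
allSeqs : ℕ → List (List Outcome)
allSeqs zero    = [] ∷ []
allSeqs (suc k) = concatMap (λ o → map (o ∷_) (allSeqs k)) outcomes

sum₁ sum₂ sum₁₂ : List Outcome → ℕ
sum₁  = foldr (λ x s → bit (proj₁ x) ℕ.+ s) 0
sum₂  = foldr (λ x s → bit (proj₂ x) ℕ.+ s) 0
sum₁₂ = foldr (λ x s → bit (proj₁ x) ℕ.* bit (proj₂ x) ℕ.+ s) 0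

sumℚ : List ℚ → ℚ
sumℚ = foldr _+_ 0ℚ

prodℚ : List ℚ → ℚ
prodℚ = foldr _*_ (+ 1 / 1)

-- i.i.d. law: the probability of a realisation is the product of the
-- single-coordinate probabilities w (X⁽ⁱ⁾)
weight : (Outcome → ℚ) → List Outcome → ℚ
weight w xs = prodℚ (map w xs)

Pr : (w : Outcome → ℚ) (k : ℕ) {E : List Outcome → Set} → Decidable E → ℚ
Pr w k E? = sumℚ (map (weight w) (filter E? (allSeqs k)))

Cond : (k : ℕ) (p p₁ p₂ : ℚ) → List Outcome → Set
Cond k p p₁ p₂ xs =
  (⟦ sum₁ xs ⟧ ≡ p₁ * ⟦ k ⟧) × (⟦ sum₂ xs ⟧ ≡ p₂ * ⟦ k ⟧) × (⟦ sum₁₂ xs ⟧ ≡ p * ⟦ k ⟧)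

cond? : (k : ℕ) (p p₁ p₂ : ℚ) → Decidable (Cond k p p₁ p₂)
cond? k p p₁ p₂ xs =
  (⟦ sum₁ xs ⟧ ≟ p₁ * ⟦ k ⟧) ×-dec (⟦ sum₂ xs ⟧ ≟ p₂ * ⟦ k ⟧) ×-dec (⟦ sum₁₂ xs ⟧ ≟ p * ⟦ k ⟧)

PrefixOK : (p₁ p₂ : ℚ) → List Outcome → ℕ → Set
PrefixOK p₁ p₂ xs l = (p₁ * ⟦ l ⟧ ≤ ⟦ sum₁ (take l xs) ⟧) × (p₂ * ⟦ l ⟧ ≤ ⟦ sum₂ (take l xs) ⟧)

prefixOK? : (p₁ p₂ : ℚ) (xs : List Outcome) → Decidable (PrefixOK p₁ p₂ xs)
prefixOK? p₁ p₂ xs l = (p₁ * ⟦ l ⟧ ≤? ⟦ sum₁ (take l xs) ⟧) ×-dec (p₂ * ⟦ l ⟧ ≤? ⟦ sum₂ (take l xs) ⟧)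

Prefix : (k : ℕ) (p₁ p₂ : ℚ) → List Outcome → Set
Prefix k p₁ p₂ xs = All (PrefixOK p₁ p₂ xs) (upTo (suc k))

prefix? : (k : ℕ) (p₁ p₂ : ℚ) → Decidable (Prefix k p₁ p₂)
prefix? k p₁ p₂ xs = all? (prefixOK? p₁ p₂ xs) (upTo (suc k))

PrefixAndCond : (k : ℕ) (p p₁ p₂ : ℚ) → List Outcome → Set
PrefixAndCond k p p₁ p₂ xs = Prefix k p₁ p₂ xs × Cond k p p₁ p₂ xs

prefixAndCond? : (k : ℕ) (p p₁ p₂ : ℚ) → Decidable (PrefixAndCond k p p₁ p₂)
prefixAndCond? k p p₁ p₂ xs = prefix? k p₁ p₂ xs ×-dec cond? k p p₁ p₂ xs

-- "q k is an integer" (q ∈ [0,1] so it is a natural number)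
IntegralMul : ℚ → ℕ → Set
IntegralMul q k = Data.Product.Σ ℕ (λ n → q * ⟦ k ⟧ ≡ ⟦ n ⟧)

{-# OPTIONS --safe #-}
-- Let s be a sequence in the conditioning event, with A ones and B zeros among its first
-- bits, a ones among the second bits at the A positions with first bit 1 and c among the
-- other B.  By the cyclic ("truck driver") lemma, starting the sequence just after a lowest
-- point of the walk j ↦ k · T j − m · j (T the prefix sums, m the total) makes every prefix
-- carry at least its share of the total.  Apply this once to the first bits, then separately
-- to the second bits at the 1-positions and at the 0-positions.  Since p ≥ p₁ p₂ means
-- a/A ≥ c/B, and every prefix contains at least the share A/k of 1-positions, the second
-- coordinates of each prefix are then above average as well.  These three rotations permute
-- the outcomes, so they preserve the weight and the conditioning event, and they are undone
-- knowing the k³ rotation amounts; hence Pr[cond] ≤ k³ · Pr[prefix ∧ cond].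
module Submission where

open import Defs
open import Data.Bool using (true; false)
open import Data.Product using (_×_; _,_)
open import Relation.Binary.PropositionalEquality using (_≡_)

module CyclicRotation where
  open import Data.Nat using (ℕ; zero; suc; pred; _+_; _*_; _∸_; _⊓_; _≤_; _≤?_; z≤n; s≤s)
  open import Data.Nat.Properties
  open import Data.Nat.ListAction.Properties using (sum-↭)
  open import Data.Nat.Tactic.RingSolver using (solve-∀)
  open import Data.List using (List; []; _∷_; _++_; take; drop; length; map; foldr; upTo)
  open import Data.List.Properties
    using (foldr-map; map-++; take-map; drop-map; length-map; take++drop≡id; take-all; take-take; take-[]; length-drop)
  open import Data.List.Membership.Propositional.Properties using (∈-upTo⁺; ∈-upTo⁻)
  open import Data.List.Relation.Binary.Permutation.Propositional using (_↭_; ↭-trans; ↭-reflexive)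
  open import Data.List.Relation.Binary.Permutation.Propositional.Properties using (++-comm; map⁺; ↭-length)
  import Data.List.Relation.Unary.All as All
  open import Data.List.Extrema.Nat using (argmin; f[argmin]≤f[xs]; f[argmin]≤f[⊤]; argmin-all)
  open import Data.Product using (∃-syntax)
  open import Data.Sum using (inj₁; inj₂)
  open import Function using (_∘_)
  open import Relation.Nullary using (yes; no)
  open import Relation.Binary.PropositionalEquality

  private variable
    A B : Set

  sumOf : (A → ℕ) → List A → ℕ
  sumOf f = foldr (λ x s → f x + s) 0

  sumOf-++ : ∀ (f : A → ℕ) xs ys → sumOf f (xs ++ ys) ≡ sumOf f xs + sumOf f ys
  sumOf-++ f []       ys = refl
  sumOf-++ f (x ∷ xs) ys = trans (cong (f x +_) (sumOf-++ f xs ys)) (sym (+-assoc (f x) _ _))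

  sumOf-map : ∀ (f : B → ℕ) (g : A → B) xs → sumOf f (map g xs) ≡ sumOf (f ∘ g) xs
  sumOf-map f g = foldr-map _ g 0

  sumOf-↭ : ∀ (f : A → ℕ) {xs ys} → xs ↭ ys → sumOf f xs ≡ sumOf f ys
  sumOf-↭ f {xs} {ys} p =
    trans (sym (foldr-map _+_ f 0 xs)) (trans (sum-↭ (map⁺ f p)) (foldr-map _+_ f 0 ys))

  sumOf-take-≤ : ∀ (f : A → ℕ) l xs → sumOf f (take l xs) ≤ sumOf f xs
  sumOf-take-≤ f zero    xs       = z≤n
  sumOf-take-≤ f (suc l) []       = z≤n
  sumOf-take-≤ f (suc l) (x ∷ xs) = +-monoʳ-≤ (f x) (sumOf-take-≤ f l xs)

  take-++ˡ : ∀ n (xs ys : List A) → n ≤ length xs → take n (xs ++ ys) ≡ take n xs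
  take-++ˡ zero    xs       ys _         = refl
  take-++ˡ (suc n) (x ∷ xs) ys (s≤s n≤) = cong (x ∷_) (take-++ˡ n xs ys n≤)

  take-++ʳ : ∀ n (xs ys : List A) → take (length xs + n) (xs ++ ys) ≡ xs ++ take n ys
  take-++ʳ n []       ys = refl
  take-++ʳ n (x ∷ xs) ys = cong (x ∷_) (take-++ʳ n xs ys)

  drop-length-++ : ∀ (xs ys : List A) → drop (length xs) (xs ++ ys) ≡ ys
  drop-length-++ []       ys = refl
  drop-length-++ (x ∷ xs) ys = drop-length-++ xs ys

  take-+ : ∀ m n (xs : List A) → take (m + n) xs ≡ take m xs ++ take n (drop m xs)
  take-+ zero    n xs       = refl
  take-+ (suc m) n []       = sym (take-[] n)
  take-+ (suc m) n (x ∷ xs) = cong (x ∷_) (take-+ m n xs)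

  rotL : ℕ → List A → List A
  rotL r xs = drop r xs ++ take r xs

  rotR : ℕ → List A → List A
  rotR r xs = rotL (length xs ∸ r) xs

  rotL-↭ : ∀ r (xs : List A) → rotL r xs ↭ xs
  rotL-↭ r xs = ↭-trans (++-comm (drop r xs) (take r xs)) (↭-reflexive (take++drop≡id r xs))

  rotR-↭ : ∀ r (xs : List A) → rotR r xs ↭ xs
  rotR-↭ r xs = rotL-↭ (length xs ∸ r) xs

  rotL-length-++ : ∀ (xs ys : List A) → rotL (length xs) (xs ++ ys) ≡ ys ++ xs
  rotL-length-++ xs ys = cong₂ _++_ (drop-length-++ xs ys)
    (trans (take-++ˡ (length xs) xs ys ≤-refl) (take-all (length xs) xs ≤-refl))

  rotR-rotL : ∀ r (xs : List A) → rotR r (rotL r xs) ≡ xs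
  rotR-rotL r xs = begin
    rotL (length (rotL r xs) ∸ r) (rotL r xs)          ≡⟨ cong (λ i → rotL i (rotL r xs)) length-drop-r ⟩
    rotL (length (drop r xs)) (drop r xs ++ take r xs) ≡⟨ rotL-length-++ (drop r xs) (take r xs) ⟩
    take r xs ++ drop r xs                             ≡⟨ take++drop≡id r xs ⟩
    xs                                                 ∎
    where
    open ≡-Reasoning
    length-drop-r : length (rotL r xs) ∸ r ≡ length (drop r xs)
    length-drop-r = trans (cong (_∸ r) (↭-length (rotL-↭ r xs))) (sym (length-drop r xs))

  map-rotL : ∀ (f : A → B) r xs → map f (rotL r xs) ≡ rotL r (map f xs)
  map-rotL f r xs =
    trans (map-++ f (drop r xs) (take r xs)) (sym (cong₂ _++_ (drop-map r xs) (take-map r xs)))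

  take-rotL-within : ∀ r l (xs : List A) → r + l ≤ length xs → take l (rotL r xs) ≡ take l (drop r xs)
  take-rotL-within r l xs r+l≤n = take-++ˡ l (drop r xs) (take r xs)
    (subst (l ≤_) (sym (length-drop r xs)) (m+n≤o⇒m≤o∸n l (subst (_≤ length xs) (+-comm r l) r+l≤n)))

  take-rotL-wrapping : ∀ r j l (xs : List A) → r ≤ length xs → length xs + j ≡ r + l → j ≤ r →
                       take l (rotL r xs) ≡ drop r xs ++ take j xs
  take-rotL-wrapping r j l xs r≤n n+j≡r+l j≤r = begin
    take l (drop r xs ++ take r xs)
      ≡⟨ cong (λ i → take i (drop r xs ++ take r xs)) (sym |D|+j≡l) ⟩
    take (length (drop r xs) + j) (drop r xs ++ take r xs)
      ≡⟨ take-++ʳ j (drop r xs) (take r xs) ⟩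
    drop r xs ++ take j (take r xs)
      ≡⟨ cong (drop r xs ++_) (take-take j r xs) ⟩
    drop r xs ++ take (j ⊓ r) xs
      ≡⟨ cong (λ i → drop r xs ++ take i xs) (m≤n⇒m⊓n≡m j≤r) ⟩
    drop r xs ++ take j xs
      ∎
    where
    open ≡-Reasoning
    n = length xs
    |D|+j≡l : length (drop r xs) + j ≡ l
    |D|+j≡l = +-cancelˡ-≡ r _ _ (begin
      r + (length (drop r xs) + j) ≡⟨ cong (λ d → r + (d + j)) (length-drop r xs) ⟩
      r + ((n ∸ r) + j)            ≡⟨ +-assoc r (n ∸ r) j ⟨
      r + (n ∸ r) + j              ≡⟨ cong (_+ j) (m+[n∸m]≡n r≤n) ⟩
      n + j                        ≡⟨ n+j≡r+l ⟩
      r + l                        ∎)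

  AboveAverage : (A → ℕ) → List A → Set
  AboveAverage f xs = ∀ l → l ≤ length xs → sumOf f xs * l ≤ length xs * sumOf f (take l xs)

  AboveAverage-map : ∀ (f : B → ℕ) (g : A → B) xs → AboveAverage f (map g xs) → AboveAverage (f ∘ g) xs
  AboveAverage-map f g xs above l l≤n = subst₂ _≤_
    (cong (_* l) (sumOf-map f g xs))
    (cong₂ _*_ (length-map g xs) (trans (cong (sumOf f) (take-map l xs)) (sumOf-map f g (take l xs))))
    (above l (subst (l ≤_) (sym (length-map g xs)) l≤n))

  exchange-≤ : ∀ x y m {d e r j n} → d + r ≡ n → e + j ≡ n →
               x + m * d ≤ y + m * e → x + m * j ≤ y + m * r
  exchange-≤ x y m {d} {e} {r} {j} refl e+j≡d+r h = +-cancelʳ-≤ (m * (d + r)) _ _ (begin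
    x + m * j + m * (d + r)     ≡⟨ regroup x m j d r ⟩
    x + m * d + (m * j + m * r) ≤⟨ +-monoˡ-≤ (m * j + m * r) h ⟩
    y + m * e + (m * j + m * r) ≡⟨ regroup′ y m e j r ⟩
    y + m * r + m * (e + j)     ≡⟨ cong (λ z → y + m * r + m * z) e+j≡d+r ⟩
    y + m * r + m * (d + r)     ∎)
    where
    open ≤-Reasoning
    regroup : ∀ x m j d r → x + m * j + m * (d + r) ≡ x + m * d + (m * j + m * r)
    regroup = solve-∀
    regroup′ : ∀ y m e j r → y + m * e + (m * j + m * r) ≡ y + m * r + m * (e + j)
    regroup′ = solve-∀

  module Walk {A : Set} (f : A → ℕ) (xs : List A) where
    private
      n m : ℕ
      n = length xs
      m = sumOf f xs

      T : ℕ → ℕ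
      T j = sumOf f (take j xs)

    -- r minimises the walk j ↦ n · T j − m · j on [0, n], stated without subtraction
    LowestPoint : ℕ → Set
    LowestPoint r = ∀ j → j ≤ n → n * T r + m * j ≤ n * T j + m * r

    lowest-point : ∃[ r ] r ≤ pred n × LowestPoint r
    lowest-point = r , r≤pred[n] , λ j j≤n → without-subtraction j j≤n (minimal j j≤n)
      where
      potential : ℕ → ℕ
      potential j = n * T j + m * (n ∸ j)

      -- j = n need not be searched since potential n ≡ potential 0; this keeps r < n
      r = argmin potential 0 (upTo n)

      r≤pred[n] : r ≤ pred n
      r≤pred[n] = argmin-all potential {xs = upTo n} z≤n (All.tabulate (<⇒≤pred ∘ ∈-upTo⁻))

      potential[0]≡potential[n] : potential 0 ≡ potential n
      potential[0]≡potential[n] = begin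
        n * 0 + m * n         ≡⟨ swap n m ⟩
        n * m + m * 0         ≡⟨ cong₂ (λ t d → n * t + m * d) (sym T[n]≡m) (sym (n∸n≡0 n)) ⟩
        n * T n + m * (n ∸ n) ∎
        where
        open ≡-Reasoning
        swap : ∀ n m → n * 0 + m * n ≡ n * m + m * 0
        swap = solve-∀
        T[n]≡m : T n ≡ m
        T[n]≡m = cong (sumOf f) (take-all n xs ≤-refl)

      minimal : ∀ j → j ≤ n → potential r ≤ potential j
      minimal j j≤n with m≤n⇒m<n∨m≡n j≤n
      ... | inj₁ j<n  = All.lookup (f[argmin]≤f[xs] {f = potential} 0 (upTo n)) (∈-upTo⁺ j<n)
      ... | inj₂ refl = ≤-trans (f[argmin]≤f[⊤] {f = potential} 0 (upTo n)) (≤-reflexive potential[0]≡potential[n])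

      without-subtraction : ∀ j → j ≤ n → potential r ≤ potential j → n * T r + m * j ≤ n * T j + m * r
      without-subtraction j j≤n =
        exchange-≤ (n * T r) (n * T j) m (m∸n+n≡m (≤pred⇒≤ r≤pred[n])) (m∸n+n≡m j≤n)

    prefix-within : ∀ {r l} → LowestPoint r → r + l ≤ n → m * l ≤ n * sumOf f (take l (rotL r xs))
    prefix-within {r} {l} low r+l≤n =
      subst (λ ys → m * l ≤ n * sumOf f ys) (sym (take-rotL-within r l xs r+l≤n))
        (cancel n (T r) m r l T[r+l]≡T[r]+c (low (r + l) r+l≤n))
      where
      T[r+l]≡T[r]+c : T (r + l) ≡ T r + sumOf f (take l (drop r xs))
      T[r+l]≡T[r]+c = trans (cong (sumOf f) (take-+ r l xs)) (sumOf-++ f (take r xs) _)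

      cancel : ∀ n t m r l {t′ c} → t′ ≡ t + c → n * t + m * (r + l) ≤ n * t′ + m * r → m * l ≤ n * c
      cancel n t m r l {c = c} refl h = +-cancelˡ-≤ (n * t + m * r) _ _ (begin
        n * t + m * r + m * l   ≡⟨ regroup n t m r l ⟩
        n * t + m * (r + l)     ≤⟨ h ⟩
        n * (t + c) + m * r     ≡⟨ regroup′ n t c m r ⟩
        n * t + m * r + n * c   ∎)
        where
        open ≤-Reasoning
        regroup : ∀ n t m r l → n * t + m * r + m * l ≡ n * t + m * (r + l)
        regroup = solve-∀
        regroup′ : ∀ n t c m r → n * (t + c) + m * r ≡ n * t + m * r + n * c
        regroup′ = solve-∀

    prefix-wrapping : ∀ {r j l} → LowestPoint r → r ≤ n → l ≤ n → n + j ≡ r + l →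
                      m * l ≤ n * sumOf f (take l (rotL r xs))
    prefix-wrapping {r} {j} {l} low r≤n l≤n n+j≡r+l =
      subst (λ ys → m * l ≤ n * sumOf f ys) (sym (take-rotL-wrapping r j l xs r≤n n+j≡r+l j≤r))
        (subst (λ s → m * l ≤ n * s) (sym (sumOf-++ f (drop r xs) (take j xs)))
          (cancel n (T r) (T j) (sumOf f (drop r xs)) j l r T[r]+d≡m n+j≡r+l (low j (≤-trans j≤r r≤n))))
      where
      j≤r : j ≤ r
      j≤r = +-cancelˡ-≤ n j r (begin
        n + j ≡⟨ n+j≡r+l ⟩
        r + l ≤⟨ +-monoʳ-≤ r l≤n ⟩
        r + n ≡⟨ +-comm r n ⟩
        n + r ∎)
        where open ≤-Reasoning

      T[r]+d≡m : T r + sumOf f (drop r xs) ≡ m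
      T[r]+d≡m = trans (sym (sumOf-++ f (take r xs) (drop r xs))) (cong (sumOf f) (take++drop≡id r xs))

      cancel : ∀ n t t′ d j l r {m} → t + d ≡ m → n + j ≡ r + l →
               n * t + m * j ≤ n * t′ + m * r → m * l ≤ n * (d + t′)
      cancel n t t′ d j l r refl n+j≡r+l h = +-cancelʳ-≤ ((t + d) * r) _ _ (begin
        (t + d) * l + (t + d) * r         ≡⟨ regroup t d l r ⟩
        (t + d) * (r + l)                 ≡⟨ cong ((t + d) *_) (sym n+j≡r+l) ⟩
        (t + d) * (n + j)                 ≡⟨ regroup′ t d n j ⟩
        n * d + (n * t + (t + d) * j)     ≤⟨ +-monoʳ-≤ (n * d) h ⟩
        n * d + (n * t′ + (t + d) * r)    ≡⟨ regroup″ n d t′ t r ⟩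
        n * (d + t′) + (t + d) * r        ∎)
        where
        open ≤-Reasoning
        regroup : ∀ t d l r → (t + d) * l + (t + d) * r ≡ (t + d) * (r + l)
        regroup = solve-∀
        regroup′ : ∀ t d n j → (t + d) * (n + j) ≡ n * d + (n * t + (t + d) * j)
        regroup′ = solve-∀
        regroup″ : ∀ n d t′ t r → n * d + (n * t′ + (t + d) * r) ≡ n * (d + t′) + (t + d) * r
        regroup″ = solve-∀

    cyclic-rotation : ∃[ r ] r ≤ pred n × AboveAverage f (rotL r xs)
    cyclic-rotation with lowest-point
    ... | r , r≤pred[n] , low = r , r≤pred[n] , above
      where
      r≤n = ≤pred⇒≤ r≤pred[n]

      prefix : ∀ l → l ≤ n → m * l ≤ n * sumOf f (take l (rotL r xs))
      prefix l l≤n with r + l ≤? n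
      ... | yes r+l≤n = prefix-within low r+l≤n
      ... | no  r+l≰n with j , n+j≡r+l ← m≤n⇒∃[o]m+o≡n (<⇒≤ (≰⇒> r+l≰n)) =
        prefix-wrapping low r≤n l≤n n+j≡r+l

      above : AboveAverage f (rotL r xs)
      above l l≤ = subst₂ (λ m′ n′ → m′ * l ≤ n′ * sumOf f (take l (rotL r xs)))
        (sym (sumOf-↭ f (rotL-↭ r xs))) (sym (↭-length (rotL-↭ r xs)))
        (prefix l (subst (l ≤_) (↭-length (rotL-↭ r xs)) l≤))

module Interleaving where
  open CyclicRotation
  open import Data.Bool using (Bool; not)
  open import Data.Nat using (ℕ; zero; suc; _+_; _*_; _≤_; z≤n)
  open import Data.Nat.Properties
  open import Data.Nat.Tactic.RingSolver using (solve-∀)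
  open import Data.List using (List; []; _∷_; _++_; take; drop; length; map)
  open import Data.List.Properties using (length-map; length-take; take-[])
  open import Data.List.Relation.Binary.Permutation.Propositional using (_↭_; ↭-trans; ↭-sym; ↭-reflexive; prep)
  open import Data.List.Relation.Binary.Permutation.Propositional.Properties using (shift)
  open import Data.Product using (proj₁; proj₂)
  open import Function using (_∘_)
  open import Algebra.Properties.CommutativeSemigroup +-commutativeSemigroup using (x∙yz≈y∙xz)
  open import Relation.Binary.PropositionalEquality

  ones zeros : List Bool → ℕ
  ones  = sumOf bit
  zeros = sumOf (bit ∘ not)

  ones+zeros≡length : ∀ bs → ones bs + zeros bs ≡ length bs
  ones+zeros≡length []           = refl
  ones+zeros≡length (true  ∷ bs) = cong suc (ones+zeros≡length bs)
  ones+zeros≡length (false ∷ bs) = trans (+-suc (ones bs) (zeros bs)) (cong suc (ones+zeros≡length bs))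

  ones≤length : ∀ bs → ones bs ≤ length bs
  ones≤length bs = subst (ones bs ≤_) (ones+zeros≡length bs) (m≤m+n (ones bs) (zeros bs))

  firsts : List Outcome → List Bool
  firsts = map proj₁

  seconds₁ seconds₀ : List Outcome → List Bool
  seconds₁ []                = []
  seconds₁ ((true  , y) ∷ s) = y ∷ seconds₁ s
  seconds₁ ((false , _) ∷ s) = seconds₁ s
  seconds₀ []                = []
  seconds₀ ((true  , _) ∷ s) = seconds₀ s
  seconds₀ ((false , y) ∷ s) = y ∷ seconds₀ s

  head⁰ : List Bool → Bool
  head⁰ []      = false
  head⁰ (y ∷ _) = y

  -- an exhausted u or v is read as 0s
  interleave : List Bool → List Bool → List Bool → List Outcome
  interleave []           u v = []
  interleave (true  ∷ bs) u v = (true  , head⁰ u) ∷ interleave bs (drop 1 u) v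
  interleave (false ∷ bs) u v = (false , head⁰ v) ∷ interleave bs u (drop 1 v)

  interleave-split : ∀ s → interleave (firsts s) (seconds₁ s) (seconds₀ s) ≡ s
  interleave-split []                = refl
  interleave-split ((true  , y) ∷ s) = cong ((true  , y) ∷_) (interleave-split s)
  interleave-split ((false , y) ∷ s) = cong ((false , y) ∷_) (interleave-split s)

  firsts-interleave : ∀ bs u v → firsts (interleave bs u v) ≡ bs
  firsts-interleave []           u v = refl
  firsts-interleave (true  ∷ bs) u v = cong (true  ∷_) (firsts-interleave bs (drop 1 u) v)
  firsts-interleave (false ∷ bs) u v = cong (false ∷_) (firsts-interleave bs u (drop 1 v))

  length-interleave : ∀ bs u v → length (interleave bs u v) ≡ length bs
  length-interleave bs u v =
    trans (sym (length-map proj₁ (interleave bs u v))) (cong length (firsts-interleave bs u v))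

  seconds₁-interleave : ∀ bs u v → length u ≡ ones bs → seconds₁ (interleave bs u v) ≡ u
  seconds₁-interleave []           []      v _  = refl
  seconds₁-interleave (true  ∷ bs) (y ∷ u) v eq = cong (y ∷_) (seconds₁-interleave bs u v (suc-injective eq))
  seconds₁-interleave (false ∷ bs) u       v eq = seconds₁-interleave bs u (drop 1 v) eq

  seconds₀-interleave : ∀ bs u v → length v ≡ zeros bs → seconds₀ (interleave bs u v) ≡ v
  seconds₀-interleave []           u []      _  = refl
  seconds₀-interleave (false ∷ bs) u (y ∷ v) eq = cong (y ∷_) (seconds₀-interleave bs u v (suc-injective eq))
  seconds₀-interleave (true  ∷ bs) u v       eq = seconds₀-interleave bs (drop 1 u) v eq

  length-seconds₁ : ∀ s → length (seconds₁ s) ≡ ones (firsts s)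
  length-seconds₁ []                = refl
  length-seconds₁ ((true  , _) ∷ s) = cong suc (length-seconds₁ s)
  length-seconds₁ ((false , _) ∷ s) = length-seconds₁ s

  length-seconds₀ : ∀ s → length (seconds₀ s) ≡ zeros (firsts s)
  length-seconds₀ []                = refl
  length-seconds₀ ((true  , _) ∷ s) = length-seconds₀ s
  length-seconds₀ ((false , _) ∷ s) = cong suc (length-seconds₀ s)

  sum₁≡ones-firsts : ∀ s → sum₁ s ≡ ones (firsts s)
  sum₁≡ones-firsts s = sym (sumOf-map bit proj₁ s)

  sum₁₂≡ones-seconds₁ : ∀ s → sum₁₂ s ≡ ones (seconds₁ s)
  sum₁₂≡ones-seconds₁ []                = refl
  sum₁₂≡ones-seconds₁ ((true  , y) ∷ s) = cong₂ _+_ (+-identityʳ (bit y)) (sum₁₂≡ones-seconds₁ s)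
  sum₁₂≡ones-seconds₁ ((false , y) ∷ s) = sum₁₂≡ones-seconds₁ s

  sum₂≡ones-seconds : ∀ s → sum₂ s ≡ ones (seconds₁ s) + ones (seconds₀ s)
  sum₂≡ones-seconds []                = refl
  sum₂≡ones-seconds ((true  , y) ∷ s) =
    trans (cong (bit y +_) (sum₂≡ones-seconds s)) (sym (+-assoc (bit y) _ _))
  sum₂≡ones-seconds ((false , y) ∷ s) =
    trans (cong (bit y +_) (sum₂≡ones-seconds s)) (x∙yz≈y∙xz (bit y) (ones (seconds₁ s)) (ones (seconds₀ s)))

  interleave-↭ : ∀ bs u v → length u ≡ ones bs → length v ≡ zeros bs →
                 interleave bs u v ↭ map (true ,_) u ++ map (false ,_) v
  interleave-↭ []           []      []      _   _   = ↭-reflexive refl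
  interleave-↭ (true  ∷ bs) (y ∷ u) v       eq₁ eq₀ = prep _ (interleave-↭ bs u v (suc-injective eq₁) eq₀)
  interleave-↭ (false ∷ bs) u       (y ∷ v) eq₁ eq₀ =
    ↭-trans (prep _ (interleave-↭ bs u v eq₁ (suc-injective eq₀))) (↭-sym (shift (false , y) (map (true ,_) u) _))

  ones-take-suc : ∀ a u → ones (take (suc a) u) ≡ bit (head⁰ u) + ones (take a (drop 1 u))
  ones-take-suc a []      = cong ones (sym (take-[] a))
  ones-take-suc a (y ∷ u) = refl

  sum₂-take-interleave : ∀ l bs u v → sum₂ (take l (interleave bs u v)) ≡
    ones (take (ones (take l bs)) u) + ones (take (zeros (take l bs)) v)
  sum₂-take-interleave zero    bs           u v = refl
  sum₂-take-interleave (suc l) []           u v = refl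
  sum₂-take-interleave (suc l) (true ∷ bs)  u v = begin
    bit (head⁰ u) + sum₂ (take l (interleave bs (drop 1 u) v))
      ≡⟨ cong (bit (head⁰ u) +_) (sum₂-take-interleave l bs (drop 1 u) v) ⟩
    bit (head⁰ u) + (ones (take m₁ (drop 1 u)) + ones (take m₀ v))
      ≡⟨ +-assoc (bit (head⁰ u)) _ _ ⟨
    bit (head⁰ u) + ones (take m₁ (drop 1 u)) + ones (take m₀ v)
      ≡⟨ cong (_+ ones (take m₀ v)) (ones-take-suc m₁ u) ⟨
    ones (take (suc m₁) u) + ones (take m₀ v)
      ∎
    where
    open ≡-Reasoning
    m₁ = ones (take l bs)
    m₀ = zeros (take l bs)
  sum₂-take-interleave (suc l) (false ∷ bs) u v = begin
    bit (head⁰ v) + sum₂ (take l (interleave bs u (drop 1 v)))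
      ≡⟨ cong (bit (head⁰ v) +_) (sum₂-take-interleave l bs u (drop 1 v)) ⟩
    bit (head⁰ v) + (ones (take m₁ u) + ones (take m₀ (drop 1 v)))
      ≡⟨ x∙yz≈y∙xz (bit (head⁰ v)) (ones (take m₁ u)) _ ⟩
    ones (take m₁ u) + (bit (head⁰ v) + ones (take m₀ (drop 1 v)))
      ≡⟨ cong (ones (take m₁ u) +_) (ones-take-suc m₀ v) ⟨
    ones (take m₁ u) + ones (take (suc m₀) v)
      ∎
    where
    open ≡-Reasoning
    m₁ = ones (take l bs)
    m₀ = zeros (take l bs)

  rearrangement-≤ : ∀ {p q x y} → p ≤ x → q ≤ y → x * q + p * y ≤ x * y + p * q
  rearrangement-≤ {p} {q} p≤x q≤y
    with d , refl ← m≤n⇒∃[o]m+o≡n p≤x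
       | e , refl ← m≤n⇒∃[o]m+o≡n q≤y
    = ≤-trans (m≤m+n _ (d * e)) (≤-reflexive (expand p q d e))
    where
    expand : ∀ p q d e → (p + d) * q + p * (q + e) + d * e ≡ (p + d) * (q + e) + p * q
    expand = solve-∀

  -- a/A ≥ c/B and m₁/(m₁+m₀) ≥ A/(A+B): more weight on the larger density
  mixture-≤ : ∀ {A B a c m₁ m₀ c₁ c₀} →
              A * c ≤ a * B → A * m₀ ≤ B * m₁ → a * m₁ ≤ A * c₁ → c * m₀ ≤ B * c₀ →
              a ≤ A → m₁ ≤ A → c ≤ B → m₀ ≤ B →
              (a + c) * (m₁ + m₀) ≤ (A + B) * (c₁ + c₀)
  mixture-≤ {zero} {B} {c₁ = c₁} {c₀} _ _ _ h₀ z≤n z≤n _ _ = ≤-trans h₀ (*-monoʳ-≤ B (m≤n+m c₀ c₁))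
  mixture-≤ {A@(suc _)} {zero} {a} {m₁ = m₁} {c₁ = c₁} {c₀} _ _ h₁ _ _ _ z≤n z≤n =
    subst₂ _≤_ (sym (cong₂ _*_ (+-identityʳ a) (+-identityʳ m₁))) (sym (cong (_* (c₁ + c₀)) (+-identityʳ A)))
      (≤-trans h₁ (*-monoʳ-≤ A (m≤m+n c₁ c₀)))
  mixture-≤ {A@(suc _)} {B@(suc _)} {a} {c} {m₁} {m₀} {c₁} {c₀} Ac≤aB Am₀≤Bm₁ h₁ h₀ _ _ _ _ =
    *-cancelˡ-≤ (A * B) (begin
      A * B * ((a + c) * (m₁ + m₀))
        ≡⟨ split A B a c m₁ m₀ ⟩
      a * B * (A * m₁) + A * c * (B * m₀) + (a * B * (A * m₀) + A * c * (B * m₁))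
        ≤⟨ +-monoʳ-≤ (a * B * (A * m₁) + A * c * (B * m₀)) (rearrangement-≤ Ac≤aB Am₀≤Bm₁) ⟩
      a * B * (A * m₁) + A * c * (B * m₀) + (a * B * (B * m₁) + A * c * (A * m₀))
        ≡⟨ collect A B a c m₁ m₀ ⟩
      (A + B) * (B * (a * m₁) + A * (c * m₀))
        ≤⟨ *-monoʳ-≤ (A + B) (+-mono-≤ (*-monoʳ-≤ B h₁) (*-monoʳ-≤ A h₀)) ⟩
      (A + B) * (B * (A * c₁) + A * (B * c₀))
        ≡⟨ factor A B c₁ c₀ ⟩
      A * B * ((A + B) * (c₁ + c₀)) ∎)
    where
    open ≤-Reasoning
    split : ∀ A B a c m₁ m₀ → A * B * ((a + c) * (m₁ + m₀)) ≡
            a * B * (A * m₁) + A * c * (B * m₀) + (a * B * (A * m₀) + A * c * (B * m₁))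
    split = solve-∀
    collect : ∀ A B a c m₁ m₀ → a * B * (A * m₁) + A * c * (B * m₀) + (a * B * (B * m₁) + A * c * (A * m₀)) ≡
              (A + B) * (B * (a * m₁) + A * (c * m₀))
    collect = solve-∀
    factor : ∀ A B c₁ c₀ → (A + B) * (B * (A * c₁) + A * (B * c₀)) ≡ A * B * ((A + B) * (c₁ + c₀))
    factor = solve-∀

  interleave-aboveAverage : ∀ bs u v → length u ≡ ones bs → length v ≡ zeros bs →
                            ones bs * ones v ≤ ones u * zeros bs →
                            AboveAverage bit bs → AboveAverage bit u → AboveAverage bit v →
                            AboveAverage (bit ∘ proj₂) (interleave bs u v)
  interleave-aboveAverage bs u v |u| |v| denser bs↑ u↑ v↑ l l≤ = begin
    sum₂ g * l                          ≡⟨ cong₂ _*_ total (sym m₁+m₀≡l) ⟩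
    (ones u + ones v) * (m₁ + m₀)       ≤⟨ mixture-≤ denser Am₀≤Bm₁ (bound u↑ |u| m₁≤A) (bound v↑ |v| m₀≤B)
                                             (subst (ones u ≤_) |u| (ones≤length u)) m₁≤A
                                             (subst (ones v ≤_) |v| (ones≤length v)) m₀≤B ⟩
    (ones bs + zeros bs) * (c₁ + c₀)    ≡⟨ cong₂ _*_ |g| (sym (sum₂-take-interleave l bs u v)) ⟩
    length g * sum₂ (take l g)          ∎
    where
    open ≤-Reasoning
    g  = interleave bs u v
    |g| : ones bs + zeros bs ≡ length g
    |g| = trans (ones+zeros≡length bs) (sym (length-interleave bs u v))
    l≤n : l ≤ length bs
    l≤n = subst (l ≤_) (length-interleave bs u v) l≤
    m₁ = ones (take l bs)
    m₀ = zeros (take l bs)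
    c₁ = ones (take m₁ u)
    c₀ = ones (take m₀ v)

    total : sum₂ g ≡ ones u + ones v
    total = trans (sum₂≡ones-seconds g)
      (cong₂ (λ x y → ones x + ones y) (seconds₁-interleave bs u v |u|) (seconds₀-interleave bs u v |v|))

    m₁+m₀≡l : m₁ + m₀ ≡ l
    m₁+m₀≡l = trans (ones+zeros≡length (take l bs)) (trans (length-take l bs) (m≤n⇒m⊓n≡m l≤n))

    m₁≤A : m₁ ≤ ones bs
    m₁≤A = sumOf-take-≤ bit l bs
    m₀≤B : m₀ ≤ zeros bs
    m₀≤B = sumOf-take-≤ (bit ∘ not) l bs

    Am₀≤Bm₁ : ones bs * m₀ ≤ zeros bs * m₁
    Am₀≤Bm₁ = +-cancelˡ-≤ (ones bs * m₁) _ _ (begin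
      ones bs * m₁ + ones bs * m₀        ≡⟨ *-distribˡ-+ (ones bs) m₁ m₀ ⟨
      ones bs * (m₁ + m₀)                ≡⟨ cong (ones bs *_) m₁+m₀≡l ⟩
      ones bs * l                        ≤⟨ bs↑ l l≤n ⟩
      length bs * m₁                     ≡⟨ cong (_* m₁) (ones+zeros≡length bs) ⟨
      (ones bs + zeros bs) * m₁          ≡⟨ *-distribʳ-+ m₁ (ones bs) (zeros bs) ⟩
      ones bs * m₁ + zeros bs * m₁       ∎)
      where open ≤-Reasoning

    bound : ∀ {w k i} → AboveAverage bit w → length w ≡ k → i ≤ k → ones w * i ≤ k * ones (take i w)
    bound w↑ refl i≤k = w↑ _ i≤k

module ClasswiseRotation where
  open CyclicRotation
  open Interleaving
  open import Data.Bool using (Bool)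
  open import Data.Nat using (ℕ; pred; _+_; _*_; _≤_; s≤s)
  open import Data.Nat.Properties
  open import Data.List using (List; []; _∷_; length)
  open import Data.List.Properties using (length-map)
  open import Data.List.Relation.Binary.Permutation.Propositional using (_↭_; ↭-trans; ↭-sym; ↭-reflexive)
  open import Data.List.Relation.Binary.Permutation.Propositional.Properties using (++⁺; map⁺; ↭-length)
  open import Data.Product using (∃-syntax; proj₁; proj₂)
  open import Function using (_∘_)
  open import Relation.Binary.PropositionalEquality

  private variable
    f g f′ g′ : List Bool → List Bool

  onSeconds : (List Bool → List Bool) → (List Bool → List Bool) → List Outcome → List Outcome
  onSeconds f g s = interleave (firsts s) (f (seconds₁ s)) (g (seconds₀ s))

  onSeconds-↭ : (∀ xs → f xs ↭ xs) → (∀ xs → g xs ↭ xs) → ∀ s → onSeconds f g s ↭ s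
  onSeconds-↭ {f} {g} f↭ g↭ s = ↭-trans
    (interleave-↭ (firsts s) (f u) (g v)
      (trans (↭-length (f↭ u)) (length-seconds₁ s)) (trans (↭-length (g↭ v)) (length-seconds₀ s)))
    (↭-trans (++⁺ (map⁺ _ (f↭ u)) (map⁺ _ (g↭ v)))
      (↭-sym (↭-trans (↭-reflexive (sym (interleave-split s)))
        (interleave-↭ (firsts s) u v (length-seconds₁ s) (length-seconds₀ s)))))
    where
    u = seconds₁ s
    v = seconds₀ s

  onSeconds-∘ : (∀ xs → length (f xs) ≡ length xs) → (∀ xs → length (g xs) ≡ length xs) →
                ∀ s → onSeconds f′ g′ (onSeconds f g s) ≡ onSeconds (f′ ∘ f) (g′ ∘ g) s
  onSeconds-∘ {f} {g} {f′} {g′} |f| |g| s = cong₃ interleave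
    (firsts-interleave (firsts s) (f u) (g v))
    (cong f′ (seconds₁-interleave (firsts s) (f u) (g v) (trans (|f| u) (length-seconds₁ s))))
    (cong g′ (seconds₀-interleave (firsts s) (f u) (g v) (trans (|g| v) (length-seconds₀ s))))
    where
    u = seconds₁ s
    v = seconds₀ s
    cong₃ : ∀ {A B C D : Set} (h : A → B → C → D) {a a′ b b′ c c′} →
            a ≡ a′ → b ≡ b′ → c ≡ c′ → h a b c ≡ h a′ b′ c′
    cong₃ h refl refl refl = refl

  Rotation : Set
  Rotation = ℕ × ℕ × ℕ

  rotate : Rotation → List Outcome → List Outcome
  rotate (r , r₁ , r₂) s = onSeconds (rotL r₁) (rotL r₂) (rotL r s)

  unrotate : Rotation → List Outcome → List Outcome
  unrotate (r , r₁ , r₂) t = rotR r (onSeconds (rotR r₁) (rotR r₂) t)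

  rotate-↭ : ∀ ρ s → rotate ρ s ↭ s
  rotate-↭ (r , r₁ , r₂) s =
    ↭-trans (onSeconds-↭ {rotL r₁} {rotL r₂} (rotL-↭ r₁) (rotL-↭ r₂) (rotL r s)) (rotL-↭ r s)

  unrotate-↭ : ∀ ρ t → unrotate ρ t ↭ t
  unrotate-↭ (r , r₁ , r₂) t =
    ↭-trans (rotR-↭ r _) (onSeconds-↭ {rotR r₁} {rotR r₂} (rotR-↭ r₁) (rotR-↭ r₂) t)

  unrotate-rotate : ∀ ρ s → unrotate ρ (rotate ρ s) ≡ s
  unrotate-rotate (r , r₁ , r₂) s = begin
    rotR r (onSeconds (rotR r₁) (rotR r₂) (onSeconds (rotL r₁) (rotL r₂) s′))
      ≡⟨ cong (rotR r) (onSeconds-∘ {f = rotL r₁} {g = rotL r₂} {f′ = rotR r₁} {g′ = rotR r₂}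
                          (↭-length ∘ rotL-↭ r₁) (↭-length ∘ rotL-↭ r₂) s′) ⟩
    rotR r (interleave (firsts s′) (rotR r₁ (rotL r₁ (seconds₁ s′))) (rotR r₂ (rotL r₂ (seconds₀ s′))))
      ≡⟨ cong (rotR r) (cong₂ (interleave (firsts s′)) (rotR-rotL r₁ _) (rotR-rotL r₂ _)) ⟩
    rotR r (interleave (firsts s′) (seconds₁ s′) (seconds₀ s′))
      ≡⟨ cong (rotR r) (interleave-split s′) ⟩
    rotR r (rotL r s)
      ≡⟨ rotR-rotL r s ⟩
    s ∎
    where
    open ≡-Reasoning
    s′ = rotL r s

  -- p ≥ p₁ p₂ multiplied by k², for the empirical frequencies of a sequence of length k
  NonnegativelyCorrelated : List Outcome → Set
  NonnegativelyCorrelated s = sum₁ s * sum₂ s ≤ length s * sum₁₂ s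

  correlated-↭ : ∀ {s t} → s ↭ t → NonnegativelyCorrelated s → NonnegativelyCorrelated t
  correlated-↭ s↭t = subst₂ _≤_
    (cong₂ _*_ (sumOf-↭ (bit ∘ proj₁) s↭t) (sumOf-↭ (bit ∘ proj₂) s↭t))
    (cong₂ _*_ (↭-length s↭t) (sumOf-↭ (λ x → bit (proj₁ x) * bit (proj₂ x)) s↭t))

  correlated⇒class₁-denser : ∀ s → NonnegativelyCorrelated s →
                 ones (firsts s) * ones (seconds₀ s) ≤ ones (seconds₁ s) * zeros (firsts s)
  correlated⇒class₁-denser s h = +-cancelˡ-≤ (A * a) _ _ (begin
    A * a + A * c       ≡⟨ *-distribˡ-+ A a c ⟨
    A * (a + c)         ≡⟨ cong₂ _*_ (sum₁≡ones-firsts s) (sum₂≡ones-seconds s) ⟨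
    sum₁ s * sum₂ s     ≤⟨ h ⟩
    length s * sum₁₂ s  ≡⟨ cong₂ _*_ |s|≡A+B (sum₁₂≡ones-seconds₁ s) ⟩
    (A + B) * a         ≡⟨ *-distribʳ-+ a A B ⟩
    A * a + B * a       ≡⟨ cong (A * a +_) (*-comm B a) ⟩
    A * a + a * B       ∎)
    where
    open ≤-Reasoning
    A = ones (firsts s)
    B = zeros (firsts s)
    a = ones (seconds₁ s)
    c = ones (seconds₀ s)
    |s|≡A+B : length s ≡ A + B
    |s|≡A+B = trans (sym (length-map proj₁ s)) (sym (ones+zeros≡length (firsts s)))

  onSeconds-aboveAverage : ∀ {f g} s → (∀ xs → f xs ↭ xs) → (∀ xs → g xs ↭ xs) →
    AboveAverage bit (firsts s) → NonnegativelyCorrelated s →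
    AboveAverage bit (f (seconds₁ s)) → AboveAverage bit (g (seconds₀ s)) →
    AboveAverage (bit ∘ proj₁) (onSeconds f g s) × AboveAverage (bit ∘ proj₂) (onSeconds f g s)
  onSeconds-aboveAverage {f} {g} s f↭ g↭ bs↑ corr u↑ v↑ =
    AboveAverage-map bit proj₁ (interleave bs u v) (subst (AboveAverage bit) (sym (firsts-interleave bs u v)) bs↑) ,
    interleave-aboveAverage bs u v |u| |v| denser bs↑ u↑ v↑
    where
    bs = firsts s
    u = f (seconds₁ s)
    v = g (seconds₀ s)

    |u| : length u ≡ ones bs
    |u| = trans (↭-length (f↭ _)) (length-seconds₁ s)
    |v| : length v ≡ zeros bs
    |v| = trans (↭-length (g↭ _)) (length-seconds₀ s)

    denser : ones bs * ones v ≤ ones u * zeros bs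
    denser = subst₂ (λ c a → ones bs * c ≤ a * zeros bs)
      (sym (sumOf-↭ bit (g↭ _))) (sym (sumOf-↭ bit (f↭ _))) (correlated⇒class₁-denser s corr)

  length-seconds₁≤ : ∀ s → length (seconds₁ s) ≤ length s
  length-seconds₁≤ []                = ≤-refl
  length-seconds₁≤ ((true  , _) ∷ s) = s≤s (length-seconds₁≤ s)
  length-seconds₁≤ ((false , _) ∷ s) = m≤n⇒m≤1+n (length-seconds₁≤ s)

  length-seconds₀≤ : ∀ s → length (seconds₀ s) ≤ length s
  length-seconds₀≤ []                = ≤-refl
  length-seconds₀≤ ((true  , _) ∷ s) = m≤n⇒m≤1+n (length-seconds₀≤ s)
  length-seconds₀≤ ((false , _) ∷ s) = s≤s (length-seconds₀≤ s)

  Bounded : ℕ → Rotation → Set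
  Bounded k (r , r₁ , r₂) = r ≤ k × r₁ ≤ k × r₂ ≤ k

  balancing-rotation : ∀ s → NonnegativelyCorrelated s →
    ∃[ ρ ] Bounded (pred (length s)) ρ ×
           AboveAverage (bit ∘ proj₁) (rotate ρ s) × AboveAverage (bit ∘ proj₂) (rotate ρ s)
  balancing-rotation s corr =
    let r  , r≤  , bs↑ = Walk.cyclic-rotation bit (firsts s)
        s′             = rotL r s
        |s′|           = ↭-length (rotL-↭ r s)
        r₁ , r₁≤ , u↑  = Walk.cyclic-rotation bit (seconds₁ s′)
        r₂ , r₂≤ , v↑  = Walk.cyclic-rotation bit (seconds₀ s′)
    in (r , r₁ , r₂) ,
       ( subst (λ n → r ≤ pred n) (length-map proj₁ s) r≤
       , ≤-trans r₁≤ (pred-mono-≤ (≤-trans (length-seconds₁≤ s′) (≤-reflexive |s′|)))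
       , ≤-trans r₂≤ (pred-mono-≤ (≤-trans (length-seconds₀≤ s′) (≤-reflexive |s′|))) ) ,
       onSeconds-aboveAverage s′ (rotL-↭ r₁) (rotL-↭ r₂)
         (subst (AboveAverage bit) (sym (map-rotL proj₁ r s)) bs↑)
         (correlated-↭ (↭-sym (rotL-↭ r s)) corr) u↑ v↑

open CyclicRotation using (sumOf-↭; AboveAverage)
open ClasswiseRotation

open import Data.Nat using (ℕ; zero; suc)
import Data.Nat as ℕ
import Data.Nat.Properties as ℕ
open import Data.Rational using (ℚ; 0ℚ; 1ℚ; _≤_; _<_; _*_; _+_; toℚᵘ; Positive; NonNegative; positive; nonNegative)
open import Data.Rational.Properties
open import Data.Empty using (⊥-elim)
open import Data.Product using (proj₁; proj₂; ∃-syntax)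
open import Data.List using (List; []; _∷_; _++_; map; concatMap; length; filter; upTo; cartesianProduct)
open import Data.List.Properties using (map-∘; map-cong; ∷-injective; length-++; length-map; length-upTo)
open import Data.List.Membership.Propositional using (_∈_; lose)
open import Data.List.Membership.Propositional.Properties
  using (∈-∃++; ∈-map⁺; ∈-concatMap⁺; ∈-filter⁺; ∈-filter⁻; ∈-upTo⁺; ∈-upTo⁻;
         ∈-cartesianProduct⁺; ∈-cartesianProductWith⁺; ∈-cartesianProductWith⁻)
open import Data.List.Relation.Unary.Any using (here; there)
open import Data.List.Relation.Unary.All using ([]; _∷_)
import Data.List.Relation.Unary.All as All
open import Data.List.Relation.Unary.Unique.Propositional using (Unique; []; _∷_)
open import Data.List.Relation.Unary.Unique.Propositional.Properties using (cartesianProductWith⁺; filter⁺)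
open import Data.List.Relation.Binary.Permutation.Propositional using (_↭_; ↭-sym; ↭⇒↭ₛ)
open import Data.List.Relation.Binary.Permutation.Propositional.Properties using (map⁺; shift; ∈-resp-↭; ↭-length)
open import Data.List.Relation.Binary.Permutation.Setoid.Properties ≡-setoid using (foldr-commMonoid)
open import Algebra.Bundles using (CommutativeMonoid)
open import Algebra.Properties.CommutativeSemigroup (CommutativeMonoid.commutativeSemigroup *-1-commutativeMonoid)
  using (interchange; xy∙z≈xz∙y)
open import Function using (_∘_)
open import Relation.Binary.PropositionalEquality
  using (refl; sym; trans; cong; cong₂; subst; subst₂; module ≡-Reasoning)

module Embedding where
  open import Data.Integer as ℤ using (+_)
  import Data.Integer.Properties as ℤ
  import Data.Rational.Unnormalised as ℚᵘ
  import Data.Rational.Unnormalised.Properties as ℚᵘ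

  private
    ⟦_⟧ᵘ : ℕ → ℚᵘ.ℚᵘ
    ⟦ n ⟧ᵘ = ℚᵘ.mkℚᵘ (+ n) 0

    toℚᵘ-⟦⟧ : ∀ n → toℚᵘ ⟦ n ⟧ ℚᵘ.≃ ⟦ n ⟧ᵘ
    toℚᵘ-⟦⟧ n = toℚᵘ-fromℚᵘ ⟦ n ⟧ᵘ

    i*1≡i : ∀ i → i ℤ.* + 1 ≡ i
    i*1≡i = ℤ.*-identityʳ

  ⟦⟧-+ : ∀ m n → ⟦ m ⟧ + ⟦ n ⟧ ≡ ⟦ m ℕ.+ n ⟧
  ⟦⟧-+ m n = toℚᵘ-injective (ℚᵘ.≃-trans (toℚᵘ-homo-+ ⟦ m ⟧ ⟦ n ⟧)
    (ℚᵘ.≃-trans (ℚᵘ.+-cong (toℚᵘ-⟦⟧ m) (toℚᵘ-⟦⟧ n))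
      (ℚᵘ.≃-trans (ℚᵘ.*≡* numerators) (ℚᵘ.≃-sym (toℚᵘ-⟦⟧ (m ℕ.+ n))))))
    where
    numerators : (+ m ℤ.* + 1 ℤ.+ + n ℤ.* + 1) ℤ.* + 1 ≡ + (m ℕ.+ n) ℤ.* + 1
    numerators = trans (i*1≡i _)
      (trans (cong₂ ℤ._+_ (i*1≡i (+ m)) (i*1≡i (+ n))) (trans (sym (ℤ.pos-+ m n)) (sym (i*1≡i _))))

  ⟦⟧-* : ∀ m n → ⟦ m ⟧ * ⟦ n ⟧ ≡ ⟦ m ℕ.* n ⟧
  ⟦⟧-* m n = toℚᵘ-injective (ℚᵘ.≃-trans (toℚᵘ-homo-* ⟦ m ⟧ ⟦ n ⟧)
    (ℚᵘ.≃-trans (ℚᵘ.*-cong (toℚᵘ-⟦⟧ m) (toℚᵘ-⟦⟧ n))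
      (ℚᵘ.≃-trans (ℚᵘ.*≡* (cong (ℤ._* + 1) (sym (ℤ.pos-* m n)))) (ℚᵘ.≃-sym (toℚᵘ-⟦⟧ (m ℕ.* n))))))

  ⟦⟧-mono-≤ : ∀ {m n} → m ℕ.≤ n → ⟦ m ⟧ ≤ ⟦ n ⟧
  ⟦⟧-mono-≤ {m} {n} m≤n = toℚᵘ-cancel-≤
    (ℚᵘ.≤-respʳ-≃ (ℚᵘ.≃-sym (toℚᵘ-⟦⟧ n)) (ℚᵘ.≤-respˡ-≃ (ℚᵘ.≃-sym (toℚᵘ-⟦⟧ m))
      (ℚᵘ.*≤* (subst₂ ℤ._≤_ (sym (i*1≡i _)) (sym (i*1≡i _)) (ℤ.+≤+ m≤n)))))

  ⟦⟧-cancel-≤ : ∀ {m n} → ⟦ m ⟧ ≤ ⟦ n ⟧ → m ℕ.≤ n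
  ⟦⟧-cancel-≤ {m} {n} ⟦m⟧≤⟦n⟧
    with ℚᵘ.*≤* le ← ℚᵘ.≤-respʳ-≃ (toℚᵘ-⟦⟧ n) (ℚᵘ.≤-respˡ-≃ (toℚᵘ-⟦⟧ m) (toℚᵘ-mono-≤ ⟦m⟧≤⟦n⟧))
    = ℤ.drop‿+≤+ (subst₂ ℤ._≤_ (i*1≡i (+ m)) (i*1≡i (+ n)) le)

open Embedding

private variable
  A B : Set

sumℚOf : (A → ℚ) → List A → ℚ
sumℚOf f xs = sumℚ (map f xs)

sumℚ-↭ : ∀ {xs ys} → xs ↭ ys → sumℚ xs ≡ sumℚ ys
sumℚ-↭ p = foldr-commMonoid +-0-isCommutativeMonoid (↭⇒↭ₛ p)

weight-↭ : ∀ w {xs ys} → xs ↭ ys → weight w xs ≡ weight w ys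
weight-↭ w p = foldr-commMonoid *-1-isCommutativeMonoid (↭⇒↭ₛ (map⁺ w p))

weight-nonneg : ∀ {w} → (∀ o → 0ℚ ≤ w o) → ∀ xs → 0ℚ ≤ weight w xs
weight-nonneg     w≥0 []       = ⟦⟧-mono-≤ {0} {1} ℕ.z≤n
weight-nonneg {w} w≥0 (x ∷ xs) = subst (_≤ w x * weight w xs) (*-zeroʳ (w x))
  (*-monoˡ-≤-nonNeg (w x) {{nonNegative (w≥0 x)}} (weight-nonneg w≥0 xs))


sumℚOf-nonneg : ∀ {f : A → ℚ} → (∀ x → 0ℚ ≤ f x) → ∀ xs → 0ℚ ≤ sumℚOf f xs
sumℚOf-nonneg f≥0 []       = ≤-refl
sumℚOf-nonneg f≥0 (x ∷ xs) = +-mono-≤ (f≥0 x) (sumℚOf-nonneg f≥0 xs)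

sumℚOf-++ : ∀ (f : A → ℚ) xs ys → sumℚOf f (xs ++ ys) ≡ sumℚOf f xs + sumℚOf f ys
sumℚOf-++ f []       ys = sym (+-identityˡ _)
sumℚOf-++ f (x ∷ xs) ys = trans (cong (f x +_) (sumℚOf-++ f xs ys)) (sym (+-assoc (f x) _ _))

sumℚOf-concatMap : ∀ (f : B → ℚ) (h : A → List B) xs →
                   sumℚOf f (concatMap h xs) ≡ sumℚOf (sumℚOf f ∘ h) xs
sumℚOf-concatMap f h []       = refl
sumℚOf-concatMap f h (x ∷ xs) =
  trans (sumℚOf-++ f (h x) (concatMap h xs)) (cong (sumℚOf f (h x) +_) (sumℚOf-concatMap f h xs))

sumℚOf-const : ∀ {f : A → ℚ} {c} → (∀ x → f x ≡ c) → ∀ xs → sumℚOf f xs ≡ ⟦ length xs ⟧ * c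
sumℚOf-const {c = c} f≡c []       = sym (*-zeroˡ c)
sumℚOf-const {f = f} {c} f≡c (x ∷ xs) = begin
  f x + sumℚOf f xs              ≡⟨ cong₂ _+_ (f≡c x) (sumℚOf-const f≡c xs) ⟩
  c + ⟦ length xs ⟧ * c          ≡⟨ cong (_+ ⟦ length xs ⟧ * c) (sym (*-identityˡ c)) ⟩
  1ℚ * c + ⟦ length xs ⟧ * c     ≡⟨ sym (*-distribʳ-+ c 1ℚ ⟦ length xs ⟧) ⟩
  (1ℚ + ⟦ length xs ⟧) * c       ≡⟨ cong (_* c) (⟦⟧-+ 1 (length xs)) ⟩
  ⟦ suc (length xs) ⟧ * c        ∎
  where open ≡-Reasoning

sumℚOf-scale : ∀ (f : A → ℚ) c xs → sumℚOf (λ x → c * f x) xs ≡ c * sumℚOf f xs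
sumℚOf-scale f c []       = sym (*-zeroʳ c)
sumℚOf-scale f c (x ∷ xs) = trans (cong (c * f x +_) (sumℚOf-scale f c xs)) (sym (*-distribˡ-+ c (f x) _))

sumℚOf-mono-⊆ : ∀ {f : A → ℚ} → (∀ x → 0ℚ ≤ f x) → ∀ {xs ys} → Unique xs →
                (∀ {x} → x ∈ xs → x ∈ ys) → sumℚOf f xs ≤ sumℚOf f ys
sumℚOf-mono-⊆ f≥0 {[]}     {ys} _             _     = sumℚOf-nonneg f≥0 ys
sumℚOf-mono-⊆ {f = f} f≥0 {x ∷ xs} {ys} (x∉xs ∷ xs!) xs⊆ys
  with ys₁ , ys₂ , refl ← ∈-∃++ (xs⊆ys (here refl)) = begin
    f x + sumℚOf f xs                  ≤⟨ +-monoʳ-≤ (f x) (sumℚOf-mono-⊆ f≥0 xs! xs⊆ys₁++ys₂) ⟩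
    sumℚOf f (x ∷ ys₁ ++ ys₂)          ≡⟨ sumℚ-↭ (map⁺ f (shift x ys₁ ys₂)) ⟨
    sumℚOf f (ys₁ ++ x ∷ ys₂)          ∎
  where
  open ≤-Reasoning
  xs⊆ys₁++ys₂ : ∀ {z} → z ∈ xs → z ∈ ys₁ ++ ys₂
  xs⊆ys₁++ys₂ z∈xs with ∈-resp-↭ (shift x ys₁ ys₂) (xs⊆ys (there z∈xs))
  ... | here refl = ⊥-elim (All.lookup x∉xs z∈xs refl)
  ... | there z∈  = z∈

⟦⟧-positive : ∀ {k} → 1 ℕ.≤ k → Positive ⟦ k ⟧
⟦⟧-positive 1≤k = positive (<-≤-trans (positive⁻¹ 1ℚ) (⟦⟧-mono-≤ 1≤k))

⟦⟧-nonNegative : ∀ n → NonNegative ⟦ n ⟧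
⟦⟧-nonNegative n = nonNegative (⟦⟧-mono-≤ {0} {n} ℕ.z≤n)

scaled-≤ : ∀ q m {k l c} → 1 ℕ.≤ k → ⟦ m ⟧ ≡ q * ⟦ k ⟧ → m ℕ.* l ℕ.≤ k ℕ.* c → q * ⟦ l ⟧ ≤ ⟦ c ⟧
scaled-≤ q m {k} {l} {c} 1≤k m≡qk ml≤kc = *-cancelʳ-≤-pos ⟦ k ⟧ {{⟦⟧-positive 1≤k}} (begin
  q * ⟦ l ⟧ * ⟦ k ⟧   ≡⟨ xy∙z≈xz∙y q ⟦ l ⟧ ⟦ k ⟧ ⟩
  q * ⟦ k ⟧ * ⟦ l ⟧   ≡⟨ cong (_* ⟦ l ⟧) m≡qk ⟨
  ⟦ m ⟧ * ⟦ l ⟧       ≡⟨ ⟦⟧-* m l ⟩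
  ⟦ m ℕ.* l ⟧         ≤⟨ ⟦⟧-mono-≤ ml≤kc ⟩
  ⟦ k ℕ.* c ⟧         ≡⟨ ⟦⟧-* k c ⟨
  ⟦ k ⟧ * ⟦ c ⟧       ≡⟨ *-comm ⟦ k ⟧ ⟦ c ⟧ ⟩
  ⟦ c ⟧ * ⟦ k ⟧       ∎)
  where open ≤-Reasoning

cond-↭ : ∀ {k p p₁ p₂ s t} → s ↭ t → Cond k p p₁ p₂ s → Cond k p p₁ p₂ t
cond-↭ s↭t (c₁ , c₂ , c₁₂) =
  trans (cong ⟦_⟧ (sumOf-↭ _ (↭-sym s↭t))) c₁ ,
  trans (cong ⟦_⟧ (sumOf-↭ _ (↭-sym s↭t))) c₂ ,
  trans (cong ⟦_⟧ (sumOf-↭ _ (↭-sym s↭t))) c₁₂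

cond⇒correlated : ∀ {k p p₁ p₂ s} → p₁ * p₂ ≤ p → length s ≡ k → Cond k p p₁ p₂ s →
                  NonnegativelyCorrelated s
cond⇒correlated {p = p} {p₁} {p₂} {s} p₁p₂≤p refl (c₁ , c₂ , c₁₂) = ⟦⟧-cancel-≤ (begin
  ⟦ sum₁ s ℕ.* sum₂ s ⟧       ≡⟨ ⟦⟧-* (sum₁ s) (sum₂ s) ⟨
  ⟦ sum₁ s ⟧ * ⟦ sum₂ s ⟧     ≡⟨ cong₂ _*_ c₁ c₂ ⟩
  p₁ * K * (p₂ * K)           ≡⟨ interchange p₁ K p₂ K ⟩
  p₁ * p₂ * (K * K)           ≤⟨ *-monoʳ-≤-nonNeg (K * K) {{K*K≥0}} p₁p₂≤p ⟩
  p * (K * K)                 ≡⟨ *-assoc p K K ⟨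
  p * K * K                   ≡⟨ cong (_* K) c₁₂ ⟨
  ⟦ sum₁₂ s ⟧ * K             ≡⟨ *-comm ⟦ sum₁₂ s ⟧ K ⟩
  K * ⟦ sum₁₂ s ⟧             ≡⟨ ⟦⟧-* (length s) (sum₁₂ s) ⟩
  ⟦ length s ℕ.* sum₁₂ s ⟧    ∎)
  where
  open ≤-Reasoning
  K = ⟦ length s ⟧
  K*K≥0 : NonNegative (K * K)
  K*K≥0 = subst NonNegative (sym (⟦⟧-* (length s) (length s))) (⟦⟧-nonNegative (length s ℕ.* length s))

aboveAverage⇒prefix : ∀ {k p p₁ p₂ g} → 1 ℕ.≤ k → length g ≡ k → Cond k p p₁ p₂ g →
                      AboveAverage (bit ∘ proj₁) g → AboveAverage (bit ∘ proj₂) g → Prefix k p₁ p₂ g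
aboveAverage⇒prefix {p₁ = p₁} {p₂} {g} 1≤k refl (c₁ , c₂ , _) above₁ above₂ = All.tabulate λ {l} l∈ →
  let l≤k = ℕ.≤-pred (∈-upTo⁻ l∈)
  in scaled-≤ p₁ (sum₁ g) 1≤k c₁ (above₁ l l≤k) , scaled-≤ p₂ (sum₂ g) 1≤k c₂ (above₂ l l≤k)

outcomes-unique : Unique outcomes
outcomes-unique = ((λ ()) ∷ (λ ()) ∷ (λ ()) ∷ []) ∷ ((λ ()) ∷ (λ ()) ∷ []) ∷ ((λ ()) ∷ []) ∷ [] ∷ []

∈-outcomes : ∀ o → o ∈ outcomes
∈-outcomes (false , false) = here refl
∈-outcomes (false , true)  = there (here refl)
∈-outcomes (true  , false) = there (there (here refl))
∈-outcomes (true  , true)  = there (there (there (here refl)))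

allSeqs-unique : ∀ k → Unique (allSeqs k)
allSeqs-unique zero    = [] ∷ []
allSeqs-unique (suc k) = cartesianProductWith⁺ _∷_ ∷-injective outcomes-unique (allSeqs-unique k)

∈-allSeqs : ∀ xs → xs ∈ allSeqs (length xs)
∈-allSeqs []       = here refl
∈-allSeqs (x ∷ xs) = ∈-cartesianProductWith⁺ _∷_ (∈-outcomes x) (∈-allSeqs xs)

length-∈-allSeqs : ∀ k {xs} → xs ∈ allSeqs k → length xs ≡ k
length-∈-allSeqs zero    (here refl) = refl
length-∈-allSeqs (suc k) xs∈
  with _ , _ , _ , ys∈ , refl ← ∈-cartesianProductWith⁻ _∷_ outcomes (allSeqs k) xs∈
  = cong suc (length-∈-allSeqs k ys∈)

rotations : ℕ → List Rotation
rotations k = cartesianProduct (upTo k) (cartesianProduct (upTo k) (upTo k))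

length-cartesianProduct : ∀ (xs : List A) (ys : List B) →
                          length (cartesianProduct xs ys) ≡ length xs ℕ.* length ys
length-cartesianProduct []       ys = refl
length-cartesianProduct (x ∷ xs) ys =
  trans (length-++ (map (x ,_) ys)) (cong₂ ℕ._+_ (length-map (x ,_) ys) (length-cartesianProduct xs ys))

length-rotations : ∀ k → length (rotations k) ≡ k ℕ.^ 3
length-rotations k = begin
  length (rotations k)             ≡⟨ length-cartesianProduct (upTo k) _ ⟩
  length (upTo k) ℕ.* length (cartesianProduct (upTo k) (upTo k))
                                   ≡⟨ cong (length (upTo k) ℕ.*_) (length-cartesianProduct (upTo k) (upTo k)) ⟩
  length (upTo k) ℕ.* (length (upTo k) ℕ.* length (upTo k))
                                   ≡⟨ cong (λ n → n ℕ.* (n ℕ.* n)) (length-upTo k) ⟩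
  k ℕ.* (k ℕ.* k)                  ≡⟨ cong (λ n → k ℕ.* (k ℕ.* n)) (ℕ.*-identityʳ k) ⟨
  k ℕ.^ 3                          ∎
  where open ≡-Reasoning

bounded∈rotations : ∀ {k ρ} → 1 ℕ.≤ k → Bounded (ℕ.pred k) ρ → ρ ∈ rotations k
bounded∈rotations {suc _} _ (r≤ , r₁≤ , r₂≤) =
  ∈-cartesianProduct⁺ (∈-upTo⁺ (ℕ.s≤s r≤))
    (∈-cartesianProduct⁺ (∈-upTo⁺ (ℕ.s≤s r₁≤)) (∈-upTo⁺ (ℕ.s≤s r₂≤)))

unrotations : ℕ → List Outcome → List (List Outcome)
unrotations k g = map (λ ρ → unrotate ρ g) (rotations k)

sumℚOf-unrotations : ∀ w k gs →
                     sumℚOf (weight w) (concatMap (unrotations k) gs) ≡ ⟦ k ℕ.^ 3 ⟧ * sumℚOf (weight w) gs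
sumℚOf-unrotations w k gs = begin
  sumℚOf W (concatMap (unrotations k) gs)  ≡⟨ sumℚOf-concatMap W (unrotations k) gs ⟩
  sumℚOf (sumℚOf W ∘ unrotations k) gs     ≡⟨ cong sumℚ (map-cong each gs) ⟩
  sumℚOf (λ g → ⟦ k ℕ.^ 3 ⟧ * W g) gs      ≡⟨ sumℚOf-scale W ⟦ k ℕ.^ 3 ⟧ gs ⟩
  ⟦ k ℕ.^ 3 ⟧ * sumℚOf W gs                ∎
  where
  open ≡-Reasoning
  W = weight w
  each : ∀ g → sumℚOf W (unrotations k g) ≡ ⟦ k ℕ.^ 3 ⟧ * W g
  each g = begin
    sumℚ (map W (map (λ ρ → unrotate ρ g) (rotations k)))
      ≡⟨ cong sumℚ (map-∘ (rotations k)) ⟨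
    sumℚOf (λ ρ → W (unrotate ρ g)) (rotations k)
      ≡⟨ sumℚOf-const (λ ρ → weight-↭ w (unrotate-↭ ρ g)) (rotations k) ⟩
    ⟦ length (rotations k) ⟧ * W g
      ≡⟨ cong (λ n → ⟦ n ⟧ * W g) (length-rotations k) ⟩
    ⟦ k ℕ.^ 3 ⟧ * W g
      ∎

cond⊆unrotations : ∀ {k p p₁ p₂} → 1 ℕ.≤ k → p₁ * p₂ ≤ p →
                   ∀ {s} → s ∈ filter (cond? k p p₁ p₂) (allSeqs k) →
                   s ∈ concatMap (unrotations k) (filter (prefixAndCond? k p p₁ p₂) (allSeqs k))
cond⊆unrotations {k} {p} {p₁} {p₂} 1≤k p₁p₂≤p {s} s∈ =
  unrotation-of-good (balancing-rotation s (cond⇒correlated {k} {p} {p₁} {p₂} {s} p₁p₂≤p |s| cond-s))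
  where
  goods = filter (prefixAndCond? k p p₁ p₂) (allSeqs k)

  s∈allSeqs×cond-s : s ∈ allSeqs k × Cond k p p₁ p₂ s
  s∈allSeqs×cond-s = ∈-filter⁻ (cond? k p p₁ p₂) {xs = allSeqs k} s∈
  cond-s = proj₂ s∈allSeqs×cond-s
  |s|    = length-∈-allSeqs k (proj₁ s∈allSeqs×cond-s)

  unrotation-of-good : ∃[ ρ ] Bounded (ℕ.pred (length s)) ρ ×
                         AboveAverage (bit ∘ proj₁) (rotate ρ s) × AboveAverage (bit ∘ proj₂) (rotate ρ s) →
                       s ∈ concatMap (unrotations k) goods
  unrotation-of-good (ρ , bounded , above₁ , above₂) =
    ∈-concatMap⁺ (unrotations k) (lose g∈goods s∈unrotations[g])
    where
    g      = rotate ρ s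
    |g|    = trans (↭-length (rotate-↭ ρ s)) |s|
    cond-g = cond-↭ {k} {p} {p₁} {p₂} (↭-sym (rotate-↭ ρ s)) cond-s

    g∈goods : g ∈ goods
    g∈goods = ∈-filter⁺ (prefixAndCond? k p p₁ p₂) (subst (λ n → g ∈ allSeqs n) |g| (∈-allSeqs g))
      (aboveAverage⇒prefix {k} {p} {p₁} {p₂} {g} 1≤k |g| cond-g above₁ above₂ , cond-g)

    s∈unrotations[g] : s ∈ unrotations k g
    s∈unrotations[g] = subst (_∈ unrotations k g) (unrotate-rotate ρ s) (∈-map⁺ (λ ρ → unrotate ρ g)
      (bounded∈rotations 1≤k (subst (λ n → Bounded (ℕ.pred n) ρ) |s| bounded)))

lemma6 : (k : ℕ) → 1 Data.Nat.≤ k →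
         (p p₁ p₂ : ℚ) →
         0ℚ ≤ p → p ≤ 1ℚ → 0ℚ ≤ p₁ → p₁ ≤ 1ℚ → 0ℚ ≤ p₂ → p₂ ≤ 1ℚ →
         IntegralMul p k → IntegralMul p₁ k → IntegralMul p₂ k →
         p₁ * p₂ ≤ p →
         (w : Outcome → ℚ) → (∀ x → 0ℚ ≤ w x) →
         w (false , false) Data.Rational.+ w (false , true)
           Data.Rational.+ w (true , false) Data.Rational.+ w (true , true) ≡ 1ℚ →
         0ℚ < Pr w k (cond? k p p₁ p₂) →
         Pr w k (cond? k p p₁ p₂)
           ≤ ⟦ k Data.Nat.^ 3 ⟧ * Pr w k (prefixAndCond? k p p₁ p₂)
lemma6 k 1≤k p p₁ p₂ _ _ _ _ _ _ _ _ _ p₁p₂≤p w w≥0 _ _ = begin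
  Pr w k (cond? k p p₁ p₂)
    ≤⟨ sumℚOf-mono-⊆ (weight-nonneg w≥0) (filter⁺ (cond? k p p₁ p₂) (allSeqs-unique k))
                     (cond⊆unrotations {k} {p} {p₁} {p₂} 1≤k p₁p₂≤p) ⟩
  sumℚOf (weight w) (concatMap (unrotations k) goods)
    ≡⟨ sumℚOf-unrotations w k goods ⟩
  ⟦ k ℕ.^ 3 ⟧ * Pr w k (prefixAndCond? k p p₁ p₂)
    ∎
  where
  open ≤-Reasoning
  goods = filter (prefixAndCond? k p p₁ p₂) (allSeqs k)
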